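{- Let $\mathbb{G}=\bigcup\limits_{i=1}^m \mathbb{G}_i$ be the disjoint union of compliant graphs $\mathbb{G}_1, \mathbb{G}_2,...,\mathbb{G}_m$, then for every vertex $a\in V(\mathbb{G}_i)$ $$_{\mathbb{G}}d_{td}(a)={_{\mathbb{G}_i}d_{td}}(a)+\sum\limits_{\substack{{j=1}\\ j\neq i}}^m\gamma_{t}(\mathbb{G}_j).$$
   Context: A total dominating set (TDS) of a graph without isolated vertices is a vertex set $S$ such that every vertex is adjacent to a vertex of $S$; a minimal TDS (MTDS) has no proper subset that is a TDS; $\gamma_t$ is the minimum cardinality of a TDS. A vertex is compliant if some MTDS contains it; a graph is compliant if all its vertices are compliant. For a vertex $a$ of a compliant graph $\mathbb{H}$, $_{\mathbb{H}}d_{td}(a)=\min\{|S| : S \text{ is an MTDS of } \mathbb{H} \text{ containing } a\}$ (total domination degree in $\mathbb{H}$). -}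

module Defs where

open import Data.Nat using (ℕ; zero; suc; _+_; _≤_)
open import Data.Fin using (Fin; zero; suc; splitAt; _↑ˡ_; _↑ʳ_; _≟_)
open import Data.Fin.Subset using (Subset; _∈_; _⊂_; ∣_∣)
open import Data.Bool using (Bool; true; false; if_then_else_)
open import Data.Sum using (inj₁; inj₂)
open import Data.Product using (Σ; ∃; _×_; _,_)
open import Data.Vec using (tabulate; sum)
open import Relation.Nullary using (¬_; yes; no; does)
open import Relation.Binary.PropositionalEquality using (_≡_; refl)

record Graph : Set where
  field
    n   : ℕ
    adj : Fin n → Fin n → Bool
open Graph public

IsSimple : Graph → Set
IsSimple G = (∀ u v → adj G u v ≡ adj G v u) × (∀ v → adj G v v ≡ false)

IsTDS : (G : Graph) → Subset (n G) → Set
IsTDS G S = ∀ v → ∃ λ u → u ∈ S × adj G v u ≡ true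

IsMTDS : (G : Graph) → Subset (n G) → Set
IsMTDS G S = IsTDS G S × (∀ T → T ⊂ S → ¬ IsTDS G T)

IsGammaT : Graph → ℕ → Set
IsGammaT G k = (∃ λ S → IsTDS G S × ∣ S ∣ ≡ k) × (∀ S → IsTDS G S → k ≤ ∣ S ∣)

Compliant : Graph → Set
Compliant G = ∀ a → ∃ λ S → IsMTDS G S × a ∈ S

IsTdDeg : (G : Graph) → Fin (n G) → ℕ → Set
IsTdDeg G a k =
  (∃ λ S → IsMTDS G S × a ∈ S × ∣ S ∣ ≡ k) ×
  (∀ S → IsMTDS G S → a ∈ S → k ≤ ∣ S ∣)

-- Disjoint union of a family G : Fin m → Graph.
-- The vertex set is Fin (n(G 0) + n(G 1) + ... ), blocks in order.
total : (m : ℕ) → (Fin m → ℕ) → ℕ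
total zero    ns = 0
total (suc m) ns = ns zero + total m (λ i → ns (suc i))

split : (m : ℕ) (ns : Fin m → ℕ) → Fin (total m ns) → Σ (Fin m) (λ i → Fin (ns i))
split (suc m) ns k with splitAt (ns zero) k
... | inj₁ x = zero , x
... | inj₂ y with split m (λ i → ns (suc i)) y
...   | i , z = suc i , z

embed : (m : ℕ) (ns : Fin m → ℕ) (i : Fin m) → Fin (ns i) → Fin (total m ns)
embed (suc m) ns zero    x = x ↑ˡ total m (λ i → ns (suc i))
embed (suc m) ns (suc i) x = ns zero ↑ʳ embed m (λ j → ns (suc j)) i x

unionAdj : (m : ℕ) (G : Fin m → Graph) →
           Σ (Fin m) (λ i → Fin (n (G i))) → Σ (Fin m) (λ i → Fin (n (G i))) → Bool
unionAdj m G (i , x) (j , y) with i ≟ j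
... | yes refl = adj (G i) x y
... | no  _    = false

Union : (m : ℕ) → (Fin m → Graph) → Graph
Union m G = record
  { n   = total m (λ i → n (G i))
  ; adj = λ u v → unionAdj m G (split m (λ i → n (G i)) u) (split m (λ i → n (G i)) v)
  }

inU : (m : ℕ) (G : Fin m → Graph) (i : Fin m) → Fin (n (G i)) → Fin (n (Union m G))
inU m G i a = embed m (λ j → n (G j)) i a

sumExcept : {m : ℕ} → Fin m → (Fin m → ℕ) → ℕ
sumExcept i g = sum (tabulate (λ j → if does (j ≟ i) then 0 else g j))

-- Edges of a disjoint union never join two components, so a vertex set of the union is a
-- (minimal) total dominating set exactly when each of its traces on the components is one,
-- and its size is the sum of the sizes of the traces. Minimising the size of an MTDS that
-- contains a thus splits into independent minimisations: over the MTDSs of G_i containing a,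
-- which gives d_td(a), and over all MTDSs of each other G_j, which gives γ_t(G_j) because a
-- minimum TDS is automatically minimal. The union of m + 1 graphs is the disjoint sum of the
-- first one and the union of the others, so induction on m reduces this to two components.
module Submission where

open import Defs
open import Data.Bool using (Bool; false)
open import Data.Fin using (Fin; zero; suc; _↑ˡ_; _↑ʳ_; _≟_)
open import Data.Fin.Properties using (splitAt-↑ˡ; splitAt-↑ʳ)
open import Data.Fin.Subset using (Subset; _∈_; _⊆_; _⊂_; ∣_∣; inside; outside)
open import Data.Fin.Subset.Properties using (p⊂q⇒∣p∣<∣q∣)
open import Data.Nat using (ℕ; zero; suc; _+_; _≤_; z≤n)
open import Data.Nat.Properties using (+-mono-≤; <⇒≱; +-commutativeSemigroup)
open import Algebra.Properties.CommutativeSemigroup +-commutativeSemigroup using (x∙yz≈y∙xz)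
open import Data.Product using (∃; _×_; _,_)
import Data.Product as Product
open import Data.Sum using (_⊎_; inj₁; inj₂)
open import Data.Vec using (Vec; []; _∷_; _++_; tabulate; sum)
import Data.Vec as Vec
open import Data.Vec.Properties using (lookup-++ˡ; lookup-++ʳ; []=⇒lookup; lookup⇒[]=)
open import Function using (_∘_; id)
open import Relation.Nullary using (¬_; yes; no; contradiction)
open import Relation.Binary.PropositionalEquality using (_≡_; refl; sym; trans; cong; cong₂; subst)

data BlockView (p q : ℕ) : Fin (p + q) → Set where
  left  : (x : Fin p) → BlockView p q (x ↑ˡ q)
  right : (y : Fin q) → BlockView p q (p ↑ʳ y)

blockView : ∀ p q (u : Fin (p + q)) → BlockView p q u
blockView zero    q u       = right u
blockView (suc p) q zero    = left zero
blockView (suc p) q (suc u) with blockView p q u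
... | left x  = left (suc x)
... | right y = right y

++-elim : ∀ {a} {A : Set a} {p q} {P : Vec A (p + q) → Set} →
          (∀ xs ys → P (xs ++ ys)) → ∀ zs → P zs
++-elim {p = p} P-++ zs with Vec.splitAt p zs
... | xs , ys , refl = P-++ xs ys

∣++∣ : ∀ {p q} (S₁ : Subset p) (S₂ : Subset q) → ∣ S₁ ++ S₂ ∣ ≡ ∣ S₁ ∣ + ∣ S₂ ∣
∣++∣ []             S₂ = refl
∣++∣ (inside  ∷ S₁) S₂ = cong suc (∣++∣ S₁ S₂)
∣++∣ (outside ∷ S₁) S₂ = ∣++∣ S₁ S₂

module _ {p q : ℕ} where

  ∈-++⁺ˡ : ∀ {x : Fin p} {S₁} (S₂ : Subset q) → x ∈ S₁ → x ↑ˡ q ∈ S₁ ++ S₂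
  ∈-++⁺ˡ {x} {S₁} S₂ x∈ =
    lookup⇒[]= (x ↑ˡ q) (S₁ ++ S₂) (trans (lookup-++ˡ S₁ S₂ x) ([]=⇒lookup x∈))

  ∈-++⁻ˡ : ∀ {x : Fin p} (S₁ : Subset p) (S₂ : Subset q) → x ↑ˡ q ∈ S₁ ++ S₂ → x ∈ S₁
  ∈-++⁻ˡ {x} S₁ S₂ x∈ =
    lookup⇒[]= x S₁ (trans (sym (lookup-++ˡ S₁ S₂ x)) ([]=⇒lookup x∈))

  ∈-++⁺ʳ : ∀ {y : Fin q} {S₂} (S₁ : Subset p) → y ∈ S₂ → p ↑ʳ y ∈ S₁ ++ S₂
  ∈-++⁺ʳ {y} {S₂} S₁ y∈ =
    lookup⇒[]= (p ↑ʳ y) (S₁ ++ S₂) (trans (lookup-++ʳ S₁ S₂ y) ([]=⇒lookup y∈))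

  ∈-++⁻ʳ : ∀ {y : Fin q} (S₁ : Subset p) (S₂ : Subset q) → p ↑ʳ y ∈ S₁ ++ S₂ → y ∈ S₂
  ∈-++⁻ʳ {y} S₁ S₂ y∈ =
    lookup⇒[]= y S₂ (trans (sym (lookup-++ʳ S₁ S₂ y)) ([]=⇒lookup y∈))

  module _ {S₁ T₁ : Subset p} {S₂ T₂ : Subset q} where

    ⊆-++ : T₁ ⊆ S₁ → T₂ ⊆ S₂ → T₁ ++ T₂ ⊆ S₁ ++ S₂
    ⊆-++ T₁⊆S₁ T₂⊆S₂ {u} u∈ with blockView p q u
    ... | left x  = ∈-++⁺ˡ S₂ (T₁⊆S₁ (∈-++⁻ˡ T₁ T₂ u∈))
    ... | right y = ∈-++⁺ʳ S₁ (T₂⊆S₂ (∈-++⁻ʳ T₁ T₂ u∈))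

    ⊂-++⁻ : T₁ ++ T₂ ⊂ S₁ ++ S₂ → T₁ ⊂ S₁ ⊎ T₂ ⊂ S₂
    ⊂-++⁻ (T⊆S , u , u∈S , u∉T) with blockView p q u
    ... | left x  = inj₁ ( (λ x∈ → ∈-++⁻ˡ S₁ S₂ (T⊆S (∈-++⁺ˡ T₂ x∈)))
                         , x , ∈-++⁻ˡ S₁ S₂ u∈S , u∉T ∘ ∈-++⁺ˡ T₂)
    ... | right y = inj₂ ( (λ y∈ → ∈-++⁻ʳ S₁ S₂ (T⊆S (∈-++⁺ʳ T₁ y∈)))
                         , y , ∈-++⁻ʳ S₁ S₂ u∈S , u∉T ∘ ∈-++⁺ʳ T₁)

  ⊂-++ˡ : ∀ {S₁ T₁ : Subset p} (S₂ : Subset q) → T₁ ⊂ S₁ → T₁ ++ S₂ ⊂ S₁ ++ S₂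
  ⊂-++ˡ {T₁ = T₁} S₂ (T₁⊆S₁ , x , x∈S₁ , x∉T₁) =
    ⊆-++ T₁⊆S₁ id , x ↑ˡ q , ∈-++⁺ˡ S₂ x∈S₁ , x∉T₁ ∘ ∈-++⁻ˡ T₁ S₂

  ⊂-++ʳ : ∀ {S₂ T₂ : Subset q} (S₁ : Subset p) → T₂ ⊂ S₂ → S₁ ++ T₂ ⊂ S₁ ++ S₂
  ⊂-++ʳ {T₂ = T₂} S₁ (T₂⊆S₂ , y , y∈S₂ , y∉T₂) =
    ⊆-++ id T₂⊆S₂ , p ↑ʳ y , ∈-++⁺ʳ S₁ y∈S₂ , y∉T₂ ∘ ∈-++⁻ʳ S₁ T₂

-- IsGammaT G c is IsLeast (IsTDS G) c by definition; IsTdDeg matches IsLeast up to reassociation.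
IsLeast : ∀ {k} → (Subset k → Set) → ℕ → Set
IsLeast P c = (∃ λ S → P S × ∣ S ∣ ≡ c) × (∀ S → P S → c ≤ ∣ S ∣)

IsLeast-++ : ∀ {p q c₁ c₂} {P₁ : Subset p → Set} {P₂ : Subset q → Set} {P : Subset (p + q) → Set} →
             (∀ {S₁ S₂} → P₁ S₁ → P₂ S₂ → P (S₁ ++ S₂)) →
             (∀ {S₁ S₂} → P (S₁ ++ S₂) → P₁ S₁ × P₂ S₂) →
             IsLeast P₁ c₁ → IsLeast P₂ c₂ → IsLeast P (c₁ + c₂)
IsLeast-++ {c₁ = c₁} {c₂} {P = P} join restrict
           ((S₁ , P₁S₁ , ∣S₁∣) , least₁) ((S₂ , P₂S₂ , ∣S₂∣) , least₂) =
  (S₁ ++ S₂ , join P₁S₁ P₂S₂ , trans (∣++∣ S₁ S₂) (cong₂ _+_ ∣S₁∣ ∣S₂∣)) , ++-elim lowerBound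
  where
  lowerBound : ∀ T₁ T₂ → P (T₁ ++ T₂) → c₁ + c₂ ≤ ∣ T₁ ++ T₂ ∣
  lowerBound T₁ T₂ PT with restrict PT
  ... | P₁T₁ , P₂T₂ =
    subst (c₁ + c₂ ≤_) (sym (∣++∣ T₁ T₂)) (+-mono-≤ (least₁ T₁ P₁T₁) (least₂ T₂ P₂T₂))

IsTdDeg⇒IsLeast : ∀ {G a c} → IsTdDeg G a c → IsLeast (λ S → IsMTDS G S × a ∈ S) c
IsTdDeg⇒IsLeast ((S , M , a∈S , ∣S∣) , least) =
  (S , (M , a∈S) , ∣S∣) , λ S (M , a∈S) → least S M a∈S

IsLeast⇒IsTdDeg : ∀ {G a c} → IsLeast (λ S → IsMTDS G S × a ∈ S) c → IsTdDeg G a c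
IsLeast⇒IsTdDeg ((S , (M , a∈S) , ∣S∣) , least) =
  (S , M , a∈S , ∣S∣) , λ S M a∈S → least S (M , a∈S)

minimumTDS⇒MTDS : ∀ {G c S} → IsGammaT G c → IsTDS G S → ∣ S ∣ ≡ c → IsMTDS G S
minimumTDS⇒MTDS (_ , least) T ∣S∣ =
  T , λ U U⊂S TU → <⇒≱ (p⊂q⇒∣p∣<∣q∣ U⊂S) (subst (_≤ ∣ U ∣) (sym ∣S∣) (least U TU))

IsGammaT⇒IsLeast-MTDS : ∀ {G c} → IsGammaT G c → IsLeast (IsMTDS G) c
IsGammaT⇒IsLeast-MTDS γ@((S , T , ∣S∣) , least) =
  (S , minimumTDS⇒MTDS γ T ∣S∣ , ∣S∣) , λ S (T , _) → least S T

-- Phrased via the adjacency function E so that Union (suc m) G is an instance on the nose,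
-- with no transport along a graph isomorphism.
record IsDisjointSum (A B : Graph) (E : Fin (n A + n B) → Fin (n A + n B) → Bool) : Set where
  field
    adj-ˡˡ : ∀ x y → E (x ↑ˡ n B) (y ↑ˡ n B) ≡ adj A x y
    adj-ˡʳ : ∀ x y → E (x ↑ˡ n B) (n A ↑ʳ y) ≡ false
    adj-ʳˡ : ∀ x y → E (n A ↑ʳ x) (y ↑ˡ n B) ≡ false
    adj-ʳʳ : ∀ x y → E (n A ↑ʳ x) (n A ↑ʳ y) ≡ adj B x y

module DisjointSum {A B : Graph} {E : Fin (n A + n B) → Fin (n A + n B) → Bool}
                   (isDisjointSum : IsDisjointSum A B E) where
  open IsDisjointSum isDisjointSum

  private
    p = n A
    q = n B

    H : Graph
    H = record { n = p + q ; adj = E }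

  IsTDS-++⁺ : ∀ {S₁ S₂} → IsTDS A S₁ → IsTDS B S₂ → IsTDS H (S₁ ++ S₂)
  IsTDS-++⁺ {S₁} {S₂} T₁ T₂ v with blockView p q v
  ... | left x  = let y , y∈ , xy = T₁ x in y ↑ˡ q , ∈-++⁺ˡ S₂ y∈ , trans (adj-ˡˡ x y) xy
  ... | right x = let y , y∈ , xy = T₂ x in p ↑ʳ y , ∈-++⁺ʳ S₁ y∈ , trans (adj-ʳʳ x y) xy

  IsTDS-++⁻ : ∀ {S₁ S₂} → IsTDS H (S₁ ++ S₂) → IsTDS A S₁ × IsTDS B S₂
  IsTDS-++⁻ {S₁} {S₂} T = dominatedˡ , dominatedʳ
    where
    dominatedˡ : IsTDS A S₁
    dominatedˡ x with T (x ↑ˡ q)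
    ... | u , u∈ , xu with blockView p q u
    ...   | left y  = y , ∈-++⁻ˡ S₁ S₂ u∈ , trans (sym (adj-ˡˡ x y)) xu
    ...   | right y = contradiction (trans (sym (adj-ˡʳ x y)) xu) λ ()
    dominatedʳ : IsTDS B S₂
    dominatedʳ x with T (p ↑ʳ x)
    ... | u , u∈ , xu with blockView p q u
    ...   | left y  = contradiction (trans (sym (adj-ʳˡ x y)) xu) λ ()
    ...   | right y = y , ∈-++⁻ʳ S₁ S₂ u∈ , trans (sym (adj-ʳʳ x y)) xu

  IsMTDS-++⁺ : ∀ {S₁ S₂} → IsMTDS A S₁ → IsMTDS B S₂ → IsMTDS H (S₁ ++ S₂)
  IsMTDS-++⁺ {S₁} {S₂} (T₁ , minimal₁) (T₂ , minimal₂) = IsTDS-++⁺ T₁ T₂ , ++-elim noSmaller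
    where
    noSmaller : ∀ U₁ U₂ → U₁ ++ U₂ ⊂ S₁ ++ S₂ → ¬ IsTDS H (U₁ ++ U₂)
    noSmaller U₁ U₂ U⊂S TU with ⊂-++⁻ U⊂S | IsTDS-++⁻ TU
    ... | inj₁ U₁⊂S₁ | TU₁ , _ = minimal₁ U₁ U₁⊂S₁ TU₁
    ... | inj₂ U₂⊂S₂ | _ , TU₂ = minimal₂ U₂ U₂⊂S₂ TU₂

  IsMTDS-++⁻ : ∀ {S₁ S₂} → IsMTDS H (S₁ ++ S₂) → IsMTDS A S₁ × IsMTDS B S₂
  IsMTDS-++⁻ {S₁} {S₂} (T , minimal) with IsTDS-++⁻ T
  ... | T₁ , T₂ =
    (T₁ , λ U₁ U₁⊂S₁ TU₁ → minimal (U₁ ++ S₂) (⊂-++ˡ S₂ U₁⊂S₁) (IsTDS-++⁺ TU₁ T₂)) ,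
    (T₂ , λ U₂ U₂⊂S₂ TU₂ → minimal (S₁ ++ U₂) (⊂-++ʳ S₁ U₂⊂S₂) (IsTDS-++⁺ T₁ TU₂))

  IsGammaT-sum : ∀ {c₁ c₂} → IsGammaT A c₁ → IsGammaT B c₂ → IsGammaT H (c₁ + c₂)
  IsGammaT-sum = IsLeast-++ IsTDS-++⁺ IsTDS-++⁻

  IsTdDeg-sumˡ : ∀ {a c₁ c₂} → IsTdDeg A a c₁ → IsGammaT B c₂ → IsTdDeg H (a ↑ˡ q) (c₁ + c₂)
  IsTdDeg-sumˡ {a} deg γ =
    IsLeast⇒IsTdDeg (IsLeast-++ join restrict (IsTdDeg⇒IsLeast deg) (IsGammaT⇒IsLeast-MTDS γ))
    where
    join : ∀ {S₁ S₂} → IsMTDS A S₁ × a ∈ S₁ → IsMTDS B S₂ → IsMTDS H (S₁ ++ S₂) × a ↑ˡ q ∈ S₁ ++ S₂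
    join {S₂ = S₂} (M₁ , a∈) M₂ = IsMTDS-++⁺ M₁ M₂ , ∈-++⁺ˡ S₂ a∈
    restrict : ∀ {S₁ S₂} → IsMTDS H (S₁ ++ S₂) × a ↑ˡ q ∈ S₁ ++ S₂ →
               (IsMTDS A S₁ × a ∈ S₁) × IsMTDS B S₂
    restrict {S₁} {S₂} (M , a∈) with IsMTDS-++⁻ M
    ... | M₁ , M₂ = (M₁ , ∈-++⁻ˡ S₁ S₂ a∈) , M₂

  IsTdDeg-sumʳ : ∀ {b c₁ c₂} → IsGammaT A c₁ → IsTdDeg B b c₂ → IsTdDeg H (p ↑ʳ b) (c₁ + c₂)
  IsTdDeg-sumʳ {b} γ deg =
    IsLeast⇒IsTdDeg (IsLeast-++ join restrict (IsGammaT⇒IsLeast-MTDS γ) (IsTdDeg⇒IsLeast deg))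
    where
    join : ∀ {S₁ S₂} → IsMTDS A S₁ → IsMTDS B S₂ × b ∈ S₂ → IsMTDS H (S₁ ++ S₂) × p ↑ʳ b ∈ S₁ ++ S₂
    join {S₁} M₁ (M₂ , b∈) = IsMTDS-++⁺ M₁ M₂ , ∈-++⁺ʳ S₁ b∈
    restrict : ∀ {S₁ S₂} → IsMTDS H (S₁ ++ S₂) × p ↑ʳ b ∈ S₁ ++ S₂ →
               IsMTDS A S₁ × (IsMTDS B S₂ × b ∈ S₂)
    restrict {S₁} {S₂} (M , b∈) with IsMTDS-++⁻ M
    ... | M₁ , M₂ = M₁ , (M₂ , ∈-++⁻ʳ S₁ S₂ b∈)

module _ (m : ℕ) (ns : Fin (suc m) → ℕ) where

  split-↑ˡ : ∀ x → split (suc m) ns (x ↑ˡ total m (ns ∘ suc)) ≡ (zero , x)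
  split-↑ˡ x rewrite splitAt-↑ˡ (ns zero) x (total m (ns ∘ suc)) = refl

  split-↑ʳ : ∀ y → split (suc m) ns (ns zero ↑ʳ y) ≡ Product.map suc id (split m (ns ∘ suc) y)
  split-↑ʳ y rewrite splitAt-↑ʳ (ns zero) (total m (ns ∘ suc)) y = refl

module _ (m : ℕ) (G : Fin (suc m) → Graph) where

  unionAdj-suc : ∀ u v → unionAdj (suc m) G (Product.map suc id u) (Product.map suc id v)
                        ≡ unionAdj m (G ∘ suc) u v
  unionAdj-suc (i , x) (j , y) with i ≟ j
  ... | yes refl = refl
  ... | no  _    = refl

  Union-isDisjointSum : IsDisjointSum (G zero) (Union m (G ∘ suc)) (adj (Union (suc m) G))
  Union-isDisjointSum = record
    { adj-ˡˡ = λ x y → cong₂ (unionAdj (suc m) G) (split-↑ˡ m ns x) (split-↑ˡ m ns y)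
    ; adj-ˡʳ = λ x y → cong₂ (unionAdj (suc m) G) (split-↑ˡ m ns x) (split-↑ʳ m ns y)
    ; adj-ʳˡ = λ x y → cong₂ (unionAdj (suc m) G) (split-↑ʳ m ns x) (split-↑ˡ m ns y)
    ; adj-ʳʳ = λ x y → trans (cong₂ (unionAdj (suc m) G) (split-↑ʳ m ns x) (split-↑ʳ m ns y))
                             (unionAdj-suc (split m (ns ∘ suc) x) (split m (ns ∘ suc) y))
    }
    where
    ns : Fin (suc m) → ℕ
    ns i = n (G i)

IsGammaT-Union : ∀ m (G : Fin m → Graph) (g : Fin m → ℕ) →
                 (∀ j → IsGammaT (G j) (g j)) → IsGammaT (Union m G) (sum (tabulate g))
IsGammaT-Union zero    G g γ = ([] , (λ ()) , refl) , λ _ _ → z≤n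
IsGammaT-Union (suc m) G g γ =
  IsGammaT-sum (γ zero) (IsGammaT-Union m (G ∘ suc) (g ∘ suc) (γ ∘ suc))
  where open DisjointSum (Union-isDisjointSum m G)

IsTdDeg-Union : ∀ m (G : Fin m → Graph) i a d (g : Fin m → ℕ) →
                IsTdDeg (G i) a d → (∀ j → IsGammaT (G j) (g j)) →
                IsTdDeg (Union m G) (inU m G i a) (d + sumExcept i g)
-- sumExcept zero g and sumExcept (suc i) g unfold definitionally to sum (tabulate (g ∘ suc))
-- and g zero + sumExcept i (g ∘ suc).
IsTdDeg-Union (suc m) G zero    a d g deg γ =
  IsTdDeg-sumˡ deg (IsGammaT-Union m (G ∘ suc) (g ∘ suc) (γ ∘ suc))
  where open DisjointSum (Union-isDisjointSum m G)
IsTdDeg-Union (suc m) G (suc i) a d g deg γ =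
  subst (IsTdDeg (Union (suc m) G) (inU (suc m) G (suc i) a))
        (x∙yz≈y∙xz (g zero) d (sumExcept i (g ∘ suc)))
        (IsTdDeg-sumʳ (γ zero) (IsTdDeg-Union m (G ∘ suc) i a d (g ∘ suc) deg (γ ∘ suc)))
  where open DisjointSum (Union-isDisjointSum m G)

theorem7 : (m : ℕ) (G : Fin m → Graph) →
             (∀ j → IsSimple (G j)) →
             (∀ j → Compliant (G j)) →
             (i : Fin m) (a : Fin (n (G i))) (d : ℕ) (g : Fin m → ℕ) →
             IsTdDeg (G i) a d →
             (∀ j → IsGammaT (G j) (g j)) →
             IsTdDeg (Union m G) (inU m G i a) (d + sumExcept i g)
theorem7 m G _ _ = IsTdDeg-Union m G
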